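{- For every term $M$ and every value $V$: if $M \to_{\ell\cup\beta}^{*} V$, then $(\widetilde{M})~\lambda x\,x \to_{a\cup\beta}^{*} \Psi(V)$.
   Context: Fix a ring of scalars (elements $\alpha,\beta$). Terms, values and base terms are given by: $M,N,L ::= V \mid (M)~N \mid \alpha.M \mid M+N$ (terms); $U,V,W ::= 0 \mid B \mid \alpha.V \mid V+W$ (values); $B ::= x \mid \lambda x\,M$ (base terms). Terms are taken up to renaming of bound variables; $M[x:=N]$ is capture-avoiding substitution. Below $V$ is a value and $B$ a base term. Rewrite rules: $(\beta_n)$ $(\lambda x\,M)~N\to M[x:=N]$. $(A)$ $(M+N)~L\to (M)~L+(N)~L$; $(\alpha.M)~N\to\alpha.(M)~N$; $(0)~M\to 0$. $(\beta_v)$ $(\lambda x\,M)~B\to M[x:=B]$. $(A_l)$ $(M+N)~V\to(M)~V+(N)~V$; $(\alpha.M)~V\to\alpha.(M)~V$; $(0)~V\to 0$. $(A_r)$ $(B)~(M+N)\to(B)~M+(B)~N$; $(B)~(\alpha.M)\to\alpha.(B)~M$; $(B)~0\to 0$. (Asso) $M+(N+L)\to(M+N)+L$ and $(M+N)+L\to M+(N+L)$. (Com) $M+N\to N+M$. $(F)$ $\alpha.M+\beta.M\to(\alpha+\beta).M$; $\alpha.M+M\to(\alpha+1).M$; $M+M\to(1+1).M$; $\alpha.(\beta.M)\to(\alpha\beta).M$. $(S)$ $\alpha.(M+N)\to\alpha.M+\alpha.N$; $1.M\to M$; $0.M\to 0$; $\alpha.0\to 0$; $0+M\to M$. Context rules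 $(\xi)$: from $M\to M'$ infer $(M)~N\to(M')~N$, $M+N\to M'+N$, $N+M\to N+M'$, $\alpha.M\to\alpha.M'$. Context rule $(\xi_{lin})$: from $M\to M'$ infer $(V)~M\to(V)~M'$ for $V$ a value. Let $L=\mathrm{Asso}\cup\mathrm{Com}\cup F\cup S$. Define: $\to_a$ generated by $A\cup L$ closed under $\xi$; $\to_\ell$ generated by $A_l\cup A_r\cup L$ closed under $\xi,\xi_{lin}$; $\to_{\beta_v}$ generated by $\beta_v$ closed under $\xi,\xi_{lin}$; $\to_{\beta_n}$ generated by $\beta_n$ closed under $\xi$. For a relation $R$, $R^{=}$ is its symmetric closure and $R^{*}$ its reflexive-transitive closure. Set $\to_{\ell\cup\beta}:=\to_\ell\cup\to_{\beta_v}$ (language $\lambda_{lin}^{\to}$), $\to^{=}_{\ell\cup\beta}:=(\to_\ell)^{=}\cup\to_{\beta_v}$ ($\lambda_{lin}^{=}$), $\to_{a\cup\beta}:=\to_a\cup\to_{\beta_n}$ ($\lambda_{alg}^{\to}$), $\to^{=}_{a\cup\beta}:=(\to_a)^{=}\cup\to_{\beta_n}$ ($\lambda_{alg}^{=}$). Translation (with $f,g,h$ fresh variables): $\widetilde{x}=\lambda f\,(f)~x$; $\widetilde{0}=0$; $\widetilde{\lambda x\,M}=\lambda f\,(f)~\lambda x\,\widetilde{M}$; $\widetilde{(M)~N}=\lambda f\,(\widetilde M)~\lambda g\,(\widetilde N)~\lambda h\,((g)~h)~f$; $\widetilde{\alpha.M}=\lambda f\,(\alpha.\widetilde M)~f$;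 $\widetilde{M+N}=\lambda f\,(\widetilde M+\widetilde N)~f$. On values: $\Psi(x)=x$, $\Psi(0)=0$, $\Psi(\lambda x\,M)=\lambda x\,\widetilde M$, $\Psi(\alpha.V)=\alpha.\Psi(V)$, $\Psi(V+W)=\Psi(V)+\Psi(W)$. -}

module Defs where

open import Level using (_⊔_; suc)
open import Data.Nat using (ℕ) renaming (zero to zeroℕ; suc to sucℕ)
open import Data.Sum using (_⊎_)
open import Algebra.Bundles using (Ring)
open import Relation.Binary.Construct.Closure.ReflexiveTransitive using (Star)

module Lambda {c ℓ} (R : Ring c ℓ) where
  open Ring R using (Carrier; 0#; 1#) renaming (_+_ to _+ᵣ_; _*_ to _*ᵣ_)

  data Term : Set c where
    var  : ℕ → Term
    lam  : Term → Term
    app  : Term → Term → Term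
    zero : Term
    smul : Carrier → Term → Term
    add  : Term → Term → Term

  data Base : Term → Set c where
    bvar : ∀ n → Base (var n)
    blam : ∀ M → Base (lam M)

  data Value : Term → Set c where
    vzero : Value zero
    vbase : ∀ {B} → Base B → Value B
    vsmul : ∀ α {V} → Value V → Value (smul α V)
    vadd  : ∀ {V W} → Value V → Value W → Value (add V W)

  ext : (ℕ → ℕ) → ℕ → ℕ
  ext ρ zeroℕ = zeroℕ
  ext ρ (sucℕ n) = sucℕ (ρ n)

  rename : (ℕ → ℕ) → Term → Term
  rename ρ (var n) = var (ρ n)
  rename ρ (lam M) = lam (rename (ext ρ) M)
  rename ρ (app M N) = app (rename ρ M) (rename ρ N)
  rename ρ zero = zero
  rename ρ (smul α M) = smul α (rename ρ M)
  rename ρ (add M N) = add (rename ρ M) (rename ρ N)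

  shift : Term → Term
  shift = rename sucℕ

  exts : (ℕ → Term) → ℕ → Term
  exts σ zeroℕ = var zeroℕ
  exts σ (sucℕ n) = shift (σ n)

  subst : (ℕ → Term) → Term → Term
  subst σ (var n) = σ n
  subst σ (lam M) = lam (subst (exts σ) M)
  subst σ (app M N) = app (subst σ M) (subst σ N)
  subst σ zero = zero
  subst σ (smul α M) = smul α (subst σ M)
  subst σ (add M N) = add (subst σ M) (subst σ N)

  subst₀ : Term → ℕ → Term
  subst₀ N zeroℕ = N
  subst₀ N (sucℕ n) = var n

  _[_] : Term → Term → Term
  M [ N ] = subst (subst₀ N) M

  Rel : Set (Level.suc c)
  Rel = Term → Term → Set c

  data L-rule : Rel where
    asso₁ : ∀ {M N K} → L-rule (add M (add N K)) (add (add M N) K)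
    asso₂ : ∀ {M N K} → L-rule (add (add M N) K) (add M (add N K))
    com   : ∀ {M N} → L-rule (add M N) (add N M)
    F₁ : ∀ {α β M} → L-rule (add (smul α M) (smul β M)) (smul (α +ᵣ β) M)
    F₂ : ∀ {α M} → L-rule (add (smul α M) M) (smul (α +ᵣ 1#) M)
    F₃ : ∀ {M} → L-rule (add M M) (smul (1# +ᵣ 1#) M)
    F₄ : ∀ {α β M} → L-rule (smul α (smul β M)) (smul (α *ᵣ β) M)
    S₁ : ∀ {α M N} → L-rule (smul α (add M N)) (add (smul α M) (smul α N))
    S₂ : ∀ {M} → L-rule (smul 1# M) M
    S₃ : ∀ {M} → L-rule (smul 0# M) zero
    S₄ : ∀ {α} → L-rule (smul α zero) zero
    S₅ : ∀ {M} → L-rule (add zero M) M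

  data A-rule : Rel where
    A₁ : ∀ {M N K} → A-rule (app (add M N) K) (add (app M K) (app N K))
    A₂ : ∀ {α M N} → A-rule (app (smul α M) N) (smul α (app M N))
    A₃ : ∀ {M} → A-rule (app zero M) zero

  data Al-rule : Rel where
    Al₁ : ∀ {M N V} → Value V → Al-rule (app (add M N) V) (add (app M V) (app N V))
    Al₂ : ∀ {α M V} → Value V → Al-rule (app (smul α M) V) (smul α (app M V))
    Al₃ : ∀ {V} → Value V → Al-rule (app zero V) zero

  data Ar-rule : Rel where
    Ar₁ : ∀ {B M N} → Base B → Ar-rule (app B (add M N)) (add (app B M) (app B N))
    Ar₂ : ∀ {B α M} → Base B → Ar-rule (app B (smul α M)) (smul α (app B M))
    Ar₃ : ∀ {B} → Base B → Ar-rule (app B zero) zero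

  data βv-rule : Rel where
    βv : ∀ {M B} → Base B → βv-rule (app (lam M) B) (M [ B ])

  data βn-rule : Rel where
    βn : ∀ {M N} → βn-rule (app (lam M) N) (M [ N ])

  _∪_ : Rel → Rel → Rel
  (R₁ ∪ R₂) M N = R₁ M N ⊎ R₂ M N

  data Cξ (Q : Rel) : Rel where
    base : ∀ {M M'} → Q M M' → Cξ Q M M'
    appL : ∀ {M M' N} → Cξ Q M M' → Cξ Q (app M N) (app M' N)
    addL : ∀ {M M' N} → Cξ Q M M' → Cξ Q (add M N) (add M' N)
    addR : ∀ {M M' N} → Cξ Q M M' → Cξ Q (add N M) (add N M')
    smulC : ∀ {α M M'} → Cξ Q M M' → Cξ Q (smul α M) (smul α M')

  data Cξlin (Q : Rel) : Rel where
    base : ∀ {M M'} → Q M M' → Cξlin Q M M'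
    appL : ∀ {M M' N} → Cξlin Q M M' → Cξlin Q (app M N) (app M' N)
    addL : ∀ {M M' N} → Cξlin Q M M' → Cξlin Q (add M N) (add M' N)
    addR : ∀ {M M' N} → Cξlin Q M M' → Cξlin Q (add N M) (add N M')
    smulC : ∀ {α M M'} → Cξlin Q M M' → Cξlin Q (smul α M) (smul α M')
    appR : ∀ {V M M'} → Value V → Cξlin Q M M' → Cξlin Q (app V M) (app V M')

  _→a_ : Rel
  _→a_ = Cξ (A-rule ∪ L-rule)

  _→ℓ_ : Rel
  _→ℓ_ = Cξlin ((Al-rule ∪ Ar-rule) ∪ L-rule)

  _→βv_ : Rel
  _→βv_ = Cξlin βv-rule

  _→βn_ : Rel
  _→βn_ = Cξ βn-rule

  _→ℓβ_ : Rel
  _→ℓβ_ = _→ℓ_ ∪ _→βv_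

  _→aβ_ : Rel
  _→aβ_ = _→a_ ∪ _→βn_

  _→ℓβ*_ : Rel
  _→ℓβ*_ = Star _→ℓβ_

  _→aβ*_ : Rel
  _→aβ*_ = Star _→aβ_

  -- The translation  M ↦ M̃  (f, g, h fresh, realised as de Bruijn binders)
  -- ext applied to shift: renaming 0 ↦ 0, k+1 ↦ k+2 (insert f under x)
  tr : Term → Term
  tr (var n) = lam (app (var 0) (var (sucℕ n)))
  tr (lam M) = lam (app (var 0) (lam (rename (ext sucℕ) (tr M))))
  tr (app M N) =
    lam (app (shift (tr M))
             (lam (app (shift (shift (tr N)))
                       (lam (app (app (var 1) (var 0)) (var 2))))))
  tr zero = zero
  tr (smul α M) = lam (app (smul α (shift (tr M))) (var 0))
  tr (add M N) = lam (app (add (shift (tr M)) (shift (tr N))) (var 0))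

  Ψ : ∀ {V} → Value V → Term
  Ψ vzero = zero
  Ψ (vbase (bvar n)) = var n
  Ψ (vbase (blam M)) = lam (tr M)
  Ψ (vsmul α v) = smul α (Ψ v)
  Ψ (vadd v w) = add (Ψ v) (Ψ w)

-- Plotkin's colon translation M : K is the result of administratively reducing (M̃) K: it
-- pushes K through the sums and scalar multiples of M down to its head base terms, where
-- K is applied to their Ψ-images.  Under the colon translation the rules A_l and A_r
-- become identities, the rules of L are mapped to the same rules, and a β_v step becomes
-- two β_n steps followed by administrative reductions; hence every λ_lin reduction
-- M →* V is simulated by a λ_alg reduction (M̃) λx x →* M : λx x →* V : λx x →* Ψ(V).
module Submission where

open import Defs
open import Algebra.Bundles using (Ring)
open import Data.Nat using (ℕ) renaming (zero to zeroℕ; suc to sucℕ)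
open import Data.Sum using (inj₁; inj₂) renaming (map to ⊎-map)
open import Function using (_∘_)
open import Relation.Binary.PropositionalEquality
  using (_≡_; refl; sym; trans; cong; cong₂; _≗_)
open import Relation.Binary.Construct.Closure.ReflexiveTransitive
  using (ε; _◅_; _◅◅_; gmap; return)
open import Relation.Binary.Construct.Closure.ReflexiveTransitive.Properties
  using (module StarReasoning)

module ColonTranslation {c ℓ} (R : Ring c ℓ) where
  open Lambda R

  ext-cong : ∀ {ρ ρ'} → ρ ≗ ρ' → ext ρ ≗ ext ρ'
  ext-cong e zeroℕ = refl
  ext-cong e (sucℕ n) = cong sucℕ (e n)

  rename-cong : ∀ {ρ ρ'} → ρ ≗ ρ' → ∀ M → rename ρ M ≡ rename ρ' M
  rename-cong e (var n) = cong var (e n)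
  rename-cong e (lam M) = cong lam (rename-cong (ext-cong e) M)
  rename-cong e (app M N) = cong₂ app (rename-cong e M) (rename-cong e N)
  rename-cong e zero = refl
  rename-cong e (smul α M) = cong (smul α) (rename-cong e M)
  rename-cong e (add M N) = cong₂ add (rename-cong e M) (rename-cong e N)

  exts-cong : ∀ {σ σ'} → σ ≗ σ' → exts σ ≗ exts σ'
  exts-cong e zeroℕ = refl
  exts-cong e (sucℕ n) = cong shift (e n)

  subst-cong : ∀ {σ σ'} → σ ≗ σ' → ∀ M → subst σ M ≡ subst σ' M
  subst-cong e (var n) = e n
  subst-cong e (lam M) = cong lam (subst-cong (exts-cong e) M)
  subst-cong e (app M N) = cong₂ app (subst-cong e M) (subst-cong e N)
  subst-cong e zero = refl
  subst-cong e (smul α M) = cong (smul α) (subst-cong e M)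
  subst-cong e (add M N) = cong₂ add (subst-cong e M) (subst-cong e N)

  ext-∘ : ∀ ρ ρ' → ext ρ ∘ ext ρ' ≗ ext (ρ ∘ ρ')
  ext-∘ ρ ρ' zeroℕ = refl
  ext-∘ ρ ρ' (sucℕ n) = refl

  rename-∘ : ∀ ρ ρ' M → rename ρ (rename ρ' M) ≡ rename (ρ ∘ ρ') M
  rename-∘ ρ ρ' (var n) = refl
  rename-∘ ρ ρ' (lam M) =
    cong lam (trans (rename-∘ (ext ρ) (ext ρ') M) (rename-cong (ext-∘ ρ ρ') M))
  rename-∘ ρ ρ' (app M N) = cong₂ app (rename-∘ ρ ρ' M) (rename-∘ ρ ρ' N)
  rename-∘ ρ ρ' zero = refl
  rename-∘ ρ ρ' (smul α M) = cong (smul α) (rename-∘ ρ ρ' M)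
  rename-∘ ρ ρ' (add M N) = cong₂ add (rename-∘ ρ ρ' M) (rename-∘ ρ ρ' N)

  rename-comm : ∀ {ρ₁ ρ₂ ρ₃ ρ₄} → ρ₁ ∘ ρ₂ ≗ ρ₃ ∘ ρ₄ →
                ∀ M → rename ρ₁ (rename ρ₂ M) ≡ rename ρ₃ (rename ρ₄ M)
  rename-comm {ρ₁} {ρ₂} {ρ₃} {ρ₄} e M =
    trans (rename-∘ ρ₁ ρ₂ M) (trans (rename-cong e M) (sym (rename-∘ ρ₃ ρ₄ M)))

  rename-ext-shift : ∀ ρ M → rename (ext ρ) (shift M) ≡ shift (rename ρ M)
  rename-ext-shift ρ = rename-comm (λ _ → refl)

  exts-∘-ext : ∀ σ ρ → exts σ ∘ ext ρ ≗ exts (σ ∘ ρ)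
  exts-∘-ext σ ρ zeroℕ = refl
  exts-∘-ext σ ρ (sucℕ n) = refl

  subst-rename : ∀ σ ρ M → subst σ (rename ρ M) ≡ subst (σ ∘ ρ) M
  subst-rename σ ρ (var n) = refl
  subst-rename σ ρ (lam M) =
    cong lam (trans (subst-rename (exts σ) (ext ρ) M) (subst-cong (exts-∘-ext σ ρ) M))
  subst-rename σ ρ (app M N) = cong₂ app (subst-rename σ ρ M) (subst-rename σ ρ N)
  subst-rename σ ρ zero = refl
  subst-rename σ ρ (smul α M) = cong (smul α) (subst-rename σ ρ M)
  subst-rename σ ρ (add M N) = cong₂ add (subst-rename σ ρ M) (subst-rename σ ρ N)

  rename-ext-∘-exts : ∀ ρ σ → rename (ext ρ) ∘ exts σ ≗ exts (rename ρ ∘ σ)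
  rename-ext-∘-exts ρ σ zeroℕ = refl
  rename-ext-∘-exts ρ σ (sucℕ n) = rename-ext-shift ρ (σ n)

  rename-subst : ∀ ρ σ M → rename ρ (subst σ M) ≡ subst (rename ρ ∘ σ) M
  rename-subst ρ σ (var n) = refl
  rename-subst ρ σ (lam M) =
    cong lam (trans (rename-subst (ext ρ) (exts σ) M) (subst-cong (rename-ext-∘-exts ρ σ) M))
  rename-subst ρ σ (app M N) = cong₂ app (rename-subst ρ σ M) (rename-subst ρ σ N)
  rename-subst ρ σ zero = refl
  rename-subst ρ σ (smul α M) = cong (smul α) (rename-subst ρ σ M)
  rename-subst ρ σ (add M N) = cong₂ add (rename-subst ρ σ M) (rename-subst ρ σ N)

  exts-var : exts var ≗ var
  exts-var zeroℕ = refl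
  exts-var (sucℕ n) = refl

  subst-var : ∀ M → subst var M ≡ M
  subst-var (var n) = refl
  subst-var (lam M) = cong lam (trans (subst-cong exts-var M) (subst-var M))
  subst-var (app M N) = cong₂ app (subst-var M) (subst-var N)
  subst-var zero = refl
  subst-var (smul α M) = cong (smul α) (subst-var M)
  subst-var (add M N) = cong₂ add (subst-var M) (subst-var N)

  subst-exts-shift : ∀ σ M → subst (exts σ) (shift M) ≡ shift (subst σ M)
  subst-exts-shift σ M = trans (subst-rename (exts σ) sucℕ M) (sym (rename-subst sucℕ σ M))

  shift-[] : ∀ M N → shift M [ N ] ≡ M
  shift-[] M N = trans (subst-rename (subst₀ N) sucℕ M) (subst-var M)

  shift²-[]-under-λ : ∀ M N → subst (exts (subst₀ N)) (shift (shift M)) ≡ shift M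
  shift²-[]-under-λ M N =
    trans (subst-exts-shift (subst₀ N) (shift M)) (cong shift (shift-[] M N))

  shift-cong-ext : ∀ {ρ X} Y → X ≡ rename ρ Y → shift X ≡ rename (ext ρ) (shift Y)
  shift-cong-ext {ρ} Y e = trans (cong shift e) (sym (rename-ext-shift ρ Y))

  shift-cong-exts : ∀ {σ X} Y → X ≡ subst σ Y → shift X ≡ subst (exts σ) (shift Y)
  shift-cong-exts {σ} Y e = trans (cong shift e) (sym (subst-exts-shift σ Y))

  tr-rename : ∀ ρ M → tr (rename ρ M) ≡ rename ρ (tr M)
  tr-rename ρ (var n) = refl
  tr-rename ρ (lam M) =
    cong (lam ∘ app (var 0)) (shift-cong-ext (lam (tr M)) (cong lam (tr-rename (ext ρ) M)))
  tr-rename ρ (app M N) =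
    cong₂ (λ X Y → lam (app X (lam (app Y (lam (app (app (var 1) (var 0)) (var 2)))))))
      (shift-cong-ext (tr M) (tr-rename ρ M))
      (shift-cong-ext (shift (tr N)) (shift-cong-ext (tr N) (tr-rename ρ N)))
  tr-rename ρ zero = refl
  tr-rename ρ (smul α M) =
    cong (λ X → lam (app (smul α X) (var 0))) (shift-cong-ext (tr M) (tr-rename ρ M))
  tr-rename ρ (add M N) =
    cong₂ (λ X Y → lam (app (add X Y) (var 0)))
      (shift-cong-ext (tr M) (tr-rename ρ M)) (shift-cong-ext (tr N) (tr-rename ρ N))

  ψ : Term → Term
  ψ (lam M) = lam (tr M)
  ψ M = M

  ψ-shift : ∀ {B} → Base B → ψ (shift B) ≡ shift (ψ B)
  ψ-shift (bvar n) = refl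
  ψ-shift (blam M) = cong lam (tr-rename (ext sucℕ) M)

  shift-base : ∀ {B} → Base B → Base (shift B)
  shift-base (bvar n) = bvar (sucℕ n)
  shift-base (blam M) = blam _

  BaseSubst : (ℕ → Term) → Set c
  BaseSubst σ = ∀ n → Base (σ n)

  exts-base : ∀ {σ} → BaseSubst σ → BaseSubst (exts σ)
  exts-base b zeroℕ = bvar 0
  exts-base b (sucℕ n) = shift-base (b n)

  ψ-exts : ∀ {σ} → BaseSubst σ → ψ ∘ exts σ ≗ exts (ψ ∘ σ)
  ψ-exts b zeroℕ = refl
  ψ-exts b (sucℕ n) = ψ-shift (b n)

  tr-base : ∀ {B} → Base B → tr B ≡ lam (app (var 0) (shift (ψ B)))
  tr-base (bvar n) = refl
  tr-base (blam M) = refl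

  tr-subst : ∀ {σ} → BaseSubst σ → ∀ M → tr (subst σ M) ≡ subst (ψ ∘ σ) (tr M)
  tr-subst b (var n) = tr-base (b n)
  tr-subst b (lam M) =
    cong (lam ∘ app (var 0)) (shift-cong-exts (lam (tr M)) (cong lam
      (trans (tr-subst (exts-base b) M) (subst-cong (ψ-exts b) (tr M)))))
  tr-subst b (app M N) =
    cong₂ (λ X Y → lam (app X (lam (app Y (lam (app (app (var 1) (var 0)) (var 2)))))))
      (shift-cong-exts (tr M) (tr-subst b M))
      (shift-cong-exts (shift (tr N)) (shift-cong-exts (tr N) (tr-subst b N)))
  tr-subst b zero = refl
  tr-subst b (smul α M) =
    cong (λ X → lam (app (smul α X) (var 0))) (shift-cong-exts (tr M) (tr-subst b M))
  tr-subst b (add M N) =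
    cong₂ (λ X Y → lam (app (add X Y) (var 0)))
      (shift-cong-exts (tr M) (tr-subst b M)) (shift-cong-exts (tr N) (tr-subst b N))

  subst₀-base : ∀ {B} → Base B → BaseSubst (subst₀ B)
  subst₀-base b zeroℕ = b
  subst₀-base b (sucℕ n) = bvar n

  ψ-∘-subst₀ : ∀ B → ψ ∘ subst₀ B ≗ subst₀ (ψ B)
  ψ-∘-subst₀ B zeroℕ = refl
  ψ-∘-subst₀ B (sucℕ n) = refl

  tr-[] : ∀ {B} → Base B → ∀ M → tr (M [ B ]) ≡ tr M [ ψ B ]
  tr-[] {B} b M = trans (tr-subst (subst₀-base b) M) (subst-cong (ψ-∘-subst₀ B) (tr M))

  β-step : ∀ {M N X} → M [ N ] ≡ X → app (lam M) N →aβ* X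
  β-step refl = return (inj₂ (base βn))

  L-step : ∀ {M M'} → L-rule M M' → M →aβ* M'
  L-step r = return (inj₁ (base (inj₂ r)))

  A-step : ∀ {M M'} → A-rule M M' → M →aβ* M'
  A-step r = return (inj₁ (base (inj₁ r)))

  appˡ-steps : ∀ {M M'} N → M →aβ* M' → app M N →aβ* app M' N
  appˡ-steps N = gmap (λ X → app X N) (⊎-map appL appL)

  smul-steps : ∀ {M M'} α → M →aβ* M' → smul α M →aβ* smul α M'
  smul-steps α = gmap (smul α) (⊎-map smulC smulC)

  add-steps : ∀ {M M' N N'} → M →aβ* M' → N →aβ* N' → add M N →aβ* add M' N'
  add-steps {M' = M'} {N = N} p q =
    gmap (λ X → add X N) (⊎-map addL addL) p ◅◅ gmap (add M') (⊎-map addR addR) q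

  -- The continuations λg. (Ñ) λh. ((g) h) K and λh. ((F) h) K met while evaluating
  -- (M) N against K, once the function, resp. the function value F, is known.
  funCont : Term → Term → Term
  funCont N K = lam (app (shift (tr N)) (lam (app (app (var 1) (var 0)) (shift (shift K)))))

  argCont : Term → Term → Term
  argCont F K = lam (app (app (shift F) (var 0)) (shift K))

  -- colon M K is Plotkin's M : K, and colonApp M N K is (M) N : K.
  colon : Term → Term → Term
  colonApp : Term → Term → Term → Term
  colon (var n) K = app K (var n)
  colon (lam P) K = app K (lam (tr P))
  colon (app M N) K = colonApp M N K
  colon zero K = zero
  colon (smul α M) K = smul α (colon M K)
  colon (add M N) K = add (colon M K) (colon N K)
  colonApp (var n) N K = colon N (argCont (var n) K)
  colonApp (lam P) N K = colon N (argCont (lam (tr P)) K)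
  colonApp (app P Q) N K = colonApp P Q (funCont N K)
  colonApp zero N K = zero
  colonApp (smul α M) N K = smul α (colonApp M N K)
  colonApp (add M M') N K = add (colonApp M N K) (colonApp M' N K)

  colon-base : ∀ {B} → Base B → ∀ K → colon B K ≡ app K (ψ B)
  colon-base (bvar n) K = refl
  colon-base (blam M) K = refl

  funCont-β : ∀ F N K → app (funCont N K) F →aβ* app (tr N) (argCont F K)
  funCont-β F N K =
    β-step (cong₂ (λ X Y → app X (lam (app (app (shift F) (var 0)) Y)))
      (shift-[] (tr N) F) (shift²-[]-under-λ K F))

  argCont-β : ∀ F X K → app (argCont F K) X →aβ* app (app F X) K
  argCont-β F X K = β-step (cong₂ (λ G L → app (app G X) L) (shift-[] F X) (shift-[] K X))

  tr-colon : ∀ M K → app (tr M) K →aβ* colon M K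
  colon-funCont : ∀ M N K → colon M (funCont N K) →aβ* colonApp M N K

  tr-colon (var n) K = β-step refl
  tr-colon (lam P) K = β-step (cong (app K) (shift-[] (lam (tr P)) K))
  tr-colon (app M N) K =
    β-step (cong₂ (λ X Y → app X (lam (app Y (lam (app (app (var 1) (var 0))
                                                       (shift (shift K)))))))
      (shift-[] (tr M) K) (shift²-[]-under-λ (tr N) K))
    ◅◅ tr-colon M (funCont N K) ◅◅ colon-funCont M N K
  tr-colon zero K = A-step A₃
  tr-colon (smul α M) K =
    β-step (cong (λ X → app (smul α X) K) (shift-[] (tr M) K))
    ◅◅ A-step A₂ ◅◅ smul-steps α (tr-colon M K)
  tr-colon (add M N) K =
    β-step (cong₂ (λ X Y → app (add X Y) K) (shift-[] (tr M) K) (shift-[] (tr N) K))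
    ◅◅ A-step A₁ ◅◅ add-steps (tr-colon M K) (tr-colon N K)

  colon-funCont (var n) N K = funCont-β (var n) N K ◅◅ tr-colon N (argCont (var n) K)
  colon-funCont (lam P) N K = funCont-β (lam (tr P)) N K ◅◅ tr-colon N (argCont (lam (tr P)) K)
  colon-funCont (app P Q) N K = ε
  colon-funCont zero N K = ε
  colon-funCont (smul α M) N K = smul-steps α (colon-funCont M N K)
  colon-funCont (add M M') N K = add-steps (colon-funCont M N K) (colon-funCont M' N K)

  ColonSimulated : Term → Term → Set c
  ColonSimulated M M' = ∀ K → colon M K →aβ* colon M' K

  -- colon is not compositional in the function position of an application,
  -- so steps there have to be simulated separately.
  record Simulated (M M' : Term) : Set c where
    constructor _,_
    field
      at-top    : ColonSimulated M M'
      under-app : ∀ N → ColonSimulated (app M N) (app M' N)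
  open Simulated

  app-simulated : ∀ {P S M'} → ColonSimulated (app P S) M' → Simulated (app P S) M'
  app-simulated {M' = M'} s = s , λ N K → s (funCont N K) ◅◅ colon-funCont M' N K

  L-colon : ∀ {M M'} → L-rule M M' → ∀ K → L-rule (colon M K) (colon M' K)
  L-colon asso₁ K = asso₁
  L-colon asso₂ K = asso₂
  L-colon com K = com
  L-colon F₁ K = F₁
  L-colon F₂ K = F₂
  L-colon F₃ K = F₃
  L-colon F₄ K = F₄
  L-colon S₁ K = S₁
  L-colon S₂ K = S₂
  L-colon S₃ K = S₃
  L-colon S₄ K = S₄
  L-colon S₅ K = S₅

  L-colonApp : ∀ {M M'} → L-rule M M' → ∀ N K → L-rule (colonApp M N K) (colonApp M' N K)
  L-colonApp asso₁ N K = asso₁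
  L-colonApp asso₂ N K = asso₂
  L-colonApp com N K = com
  L-colonApp F₁ N K = F₁
  L-colonApp F₂ N K = F₂
  L-colonApp F₃ N K = F₃
  L-colonApp F₄ N K = F₄
  L-colonApp S₁ N K = S₁
  L-colonApp S₂ N K = S₂
  L-colonApp S₃ N K = S₃
  L-colonApp S₄ N K = S₄
  L-colonApp S₅ N K = S₅

  L-simulated : ∀ {M M'} → L-rule M M' → Simulated M M'
  L-simulated r = (λ K → L-step (L-colon r K)) , (λ N K → L-step (L-colonApp r N K))

  -- Both sides of an A_l or A_r rule have the same colon translation.
  Al-simulated : ∀ {M M'} → Al-rule M M' → Simulated M M'
  Al-simulated (Al₁ _) = app-simulated (λ K → ε)
  Al-simulated (Al₂ _) = app-simulated (λ K → ε)
  Al-simulated (Al₃ _) = app-simulated (λ K → ε)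

  Ar-simulated : ∀ {M M'} → Ar-rule M M' → Simulated M M'
  Ar-simulated (Ar₁ (bvar n)) = app-simulated (λ K → ε)
  Ar-simulated (Ar₁ (blam P)) = app-simulated (λ K → ε)
  Ar-simulated (Ar₂ (bvar n)) = app-simulated (λ K → ε)
  Ar-simulated (Ar₂ (blam P)) = app-simulated (λ K → ε)
  Ar-simulated (Ar₃ (bvar n)) = app-simulated (λ K → ε)
  Ar-simulated (Ar₃ (blam P)) = app-simulated (λ K → ε)

  βv-colon : ∀ {B} → Base B → ∀ P → ColonSimulated (app (lam P) B) (P [ B ])
  βv-colon {B} b P K = begin
    colon (app (lam P) B) K            ≡⟨ colon-base b _ ⟩
    app (argCont (lam (tr P)) K) (ψ B) ⟶*⟨ argCont-β (lam (tr P)) (ψ B) K ⟩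
    app (app (lam (tr P)) (ψ B)) K     ⟶*⟨ appˡ-steps K (β-step (sym (tr-[] b P))) ⟩
    app (tr (P [ B ])) K               ⟶*⟨ tr-colon (P [ B ]) K ⟩
    colon (P [ B ]) K                  ∎
    where open StarReasoning _→aβ_

  βv-simulated : ∀ {M M'} → βv-rule M M' → Simulated M M'
  βv-simulated (βv b) = app-simulated (βv-colon b _)

  colon-appʳ : ∀ {V M M'} → Value V → ColonSimulated M M' →
               ColonSimulated (app V M) (app V M')
  colon-appʳ vzero s K = ε
  colon-appʳ (vbase (bvar n)) s K = s (argCont (var n) K)
  colon-appʳ (vbase (blam P)) s K = s (argCont (lam (tr P)) K)
  colon-appʳ (vsmul α v) s K = smul-steps α (colon-appʳ v s K)
  colon-appʳ (vadd v w) s K = add-steps (colon-appʳ v s K) (colon-appʳ w s K)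

  Cξlin-simulated : ∀ {Q : Rel} → (∀ {M M'} → Q M M' → Simulated M M') →
                    ∀ {M M'} → Cξlin Q M M' → Simulated M M'
  Cξlin-simulated top (base r) = top r
  Cξlin-simulated top (appL {N = N} d) = app-simulated (under-app (Cξlin-simulated top d) N)
  Cξlin-simulated top (addL d) =
    (λ K → add-steps (at-top s K) ε) , (λ N K → add-steps (under-app s N K) ε)
    where s = Cξlin-simulated top d
  Cξlin-simulated top (addR d) =
    (λ K → add-steps ε (at-top s K)) , (λ N K → add-steps ε (under-app s N K))
    where s = Cξlin-simulated top d
  Cξlin-simulated top (smulC d) =
    (λ K → smul-steps _ (at-top s K)) , (λ N K → smul-steps _ (under-app s N K))
    where s = Cξlin-simulated top d
  Cξlin-simulated top (appR v d) = app-simulated (colon-appʳ v (at-top (Cξlin-simulated top d)))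

  ℓ-simulated : ∀ {M M'} → ((Al-rule ∪ Ar-rule) ∪ L-rule) M M' → Simulated M M'
  ℓ-simulated (inj₁ (inj₁ r)) = Al-simulated r
  ℓ-simulated (inj₁ (inj₂ r)) = Ar-simulated r
  ℓ-simulated (inj₂ r) = L-simulated r

  colon-step : ∀ {M M'} → M →ℓβ M' → ColonSimulated M M'
  colon-step (inj₁ s) = at-top (Cξlin-simulated ℓ-simulated s)
  colon-step (inj₂ s) = at-top (Cξlin-simulated βv-simulated s)

  colon-steps : ∀ {M M'} → M →ℓβ* M' → ColonSimulated M M'
  colon-steps ε K = ε
  colon-steps (s ◅ ss) K = colon-step s K ◅◅ colon-steps ss K

  colon-value : ∀ {V} (v : Value V) → colon V (lam (var 0)) →aβ* Ψ v
  colon-value vzero = ε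
  colon-value (vbase (bvar n)) = β-step refl
  colon-value (vbase (blam M)) = β-step refl
  colon-value (vsmul α v) = smul-steps α (colon-value v)
  colon-value (vadd v w) = add-steps (colon-value v) (colon-value w)

theorem6 : ∀ {c ℓ} (R : Ring c ℓ) → let open Lambda R in
    ∀ (M V : Term) (v : Value V) →
      M →ℓβ* V → app (tr M) (lam (var 0)) →aβ* Ψ v
theorem6 R M V v M→*V = tr-colon M I ◅◅ colon-steps M→*V I ◅◅ colon-value v
  where
  open Lambda R
  open ColonTranslation R

  I : Term
  I = lam (var 0)
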